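{- For all integers $m,n\ge 2$, $\gamma_I(C_m \otimes C_n) = \left\lceil \frac{mn}{2}\right\rceil$.
   Context: For an integer $k\ge 2$, $C_k$ denotes the directed cycle with vertex set $\{1,2,\dots,k\}$ and arcs $i\rightarrow i+1$ (indices taken modulo $k$). For digraphs $D_1=(V_1,A_1)$ and $D_2=(V_2,A_2)$, the strong product $D_1\otimes D_2$ is the digraph with vertex set $V_1\times V_2$ in which $(x_1,x_2)\rightarrow(y_1,y_2)$ is an arc if and only if one of the following holds: ($x_1\rightarrow y_1$ in $D_1$ and $x_2\rightarrow y_2$ in $D_2$); ($x_1=y_1$ and $x_2\rightarrow y_2$ in $D_2$); ($x_1\rightarrow y_1$ in $D_1$ and $x_2=y_2$). An Italian dominating function on a digraph $D$ is a function $f:V(D)\to\{0,1,2\}$ such that every vertex $v$ with $f(v)=0$ has at least two in-neighbors $u$ with $f(u)=1$ or at least one in-neighbor $w$ with $f(w)=2$ (an in-neighbor of $v$ is a vertex $u$ with $u\rightarrow v$). Its weight is $\sum_{u\in V(D)} f(u)$, and the Italian domination number $\gamma_I(D)$ is the minimum weight of an Italian dominating function on $D$. -}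

module Defs where

open import Data.Nat using (ℕ; zero; suc; _+_; _*_; _≤_; _%_; NonZero)
open import Data.Nat.Properties using ()
open import Data.Fin using (Fin; toℕ)
open import Data.Product using (_×_; _,_; Σ; ∃)
open import Data.Sum using (_⊎_)
open import Data.List using (List; allFin; cartesianProduct; map)
open import Data.Nat.ListAction using (sum)
open import Relation.Binary.PropositionalEquality using (_≡_; _≢_)
open import Relation.Nullary using (¬_)

record Digraph : Set₁ where
  field
    V     : Set
    verts : List V            -- enumeration of all vertices (each exactly once)
    Arc   : V → V → Set

open Digraph public

-- The directed cycle C_k on vertices Fin k (vertex i ↔ paper's i+1);
-- arcs i → i+1 (mod k), i.e. j = i+1, or i = k-1 and j = 0.
Cycle : (k : ℕ) → Digraph
Cycle k = record
  { V     = Fin k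
  ; verts = allFin k
  ; Arc   = λ i j → (toℕ j ≡ suc (toℕ i)) ⊎ (suc (toℕ i) ≡ k × toℕ j ≡ 0)
  }

_⊗_ : Digraph → Digraph → Digraph
D₁ ⊗ D₂ = record
  { V     = V D₁ × V D₂
  ; verts = cartesianProduct (verts D₁) (verts D₂)
  ; Arc   = λ { (x₁ , x₂) (y₁ , y₂) →
                (Arc D₁ x₁ y₁ × Arc D₂ x₂ y₂)
              ⊎ (x₁ ≡ y₁ × Arc D₂ x₂ y₂)
              ⊎ (Arc D₁ x₁ y₁ × x₂ ≡ y₂) }
  }

Label : Set
Label = Fin 3

val : Label → ℕ
val = toℕ

IsItalian : (D : Digraph) → (V D → Label) → Set
IsItalian D f =
  ∀ v → val (f v) ≡ 0 →
    (Σ (V D) λ w → Arc D w v × val (f w) ≡ 2)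
  ⊎ (Σ (V D) λ u₁ → Σ (V D) λ u₂ →
        u₁ ≢ u₂ × Arc D u₁ v × Arc D u₂ v × val (f u₁) ≡ 1 × val (f u₂) ≡ 1)

weight : (D : Digraph) → (V D → Label) → ℕ
weight D f = sum (map (λ v → val (f v)) (verts D))

ItalianDominationNumber : Digraph → ℕ → Set
ItalianDominationNumber D k =
  (Σ (V D → Label) λ f → IsItalian D f × weight D f ≡ k)
  × (∀ (f : V D → Label) → IsItalian D f → k ≤ weight D f)

⌈_/2⌉ : ℕ → ℕ
⌈ x /2⌉ = Data.Nat._/_ (x + 1) 2

-- Lower bound: along a pair of consecutive columns (x - 1, x) of the torus, let s y be the
-- total label of the two cells in row y.  If s y = 0, then the Italian condition at (x, y)
-- forces s (y - 1) ≥ 2, so with the potential "s y ≥ 2" the inequality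
-- 1 + [s y ≥ 2] ≤ s y + [s (y - 1) ≥ 2] holds row by row and telescopes around the cycle
-- to n ≤ ∑ s.  Summing over x counts every label twice, hence mn ≤ 2 w(f).
-- Upper bound: the checkerboard labelling (1 exactly where x + y is even) is Italian, since
-- every 0 sees two 1s among its three in-neighbours; consecutive rows carry n labels in total
-- and each row at most ⌈n/2⌉, so its weight is ⌈mn/2⌉.
module Submission where

open import Defs
open import Data.Nat using (ℕ; _≤_; _*_)
open import Data.Nat using (zero; suc; _+_; z≤n; s≤s; _<_; _/_)
open import Data.Nat.Properties
open import Data.Nat.DivMod using (m*n/n≡m; /-monoˡ-≤; m<n*o⇒m/o<n)
open import Data.Nat.ListAction using (sum)
open import Data.Nat.ListAction.Properties using (sum-++)
open import Data.Fin using (Fin; zero; suc; toℕ; fromℕ; inject₁)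
open import Data.Fin.Patterns using (0F; 1F)
open import Data.Fin.Properties using (toℕ-fromℕ; toℕ-inject₁; toℕ-injective) renaming (suc-injective to suc-injectiveᶠ)
open import Data.Product using (Σ; _×_; _,_; proj₁; proj₂)
open import Data.Sum using (_⊎_; inj₁; inj₂)
open import Data.List using (List; []; _∷_; _++_; map; tabulate; allFin; cartesianProduct)
open import Data.List.Properties using (map-++; map-∘; map-cong; map-tabulate)
open import Function using (_∘_; id)
open import Relation.Binary.PropositionalEquality
open import Relation.Nullary using (contradiction)
open import Algebra.Properties.CommutativeSemigroup +-commutativeSemigroup
  using () renaming (interchange to +-interchange)
open import Algebra.Properties.CommutativeMonoid.Sum +-0-commutativeMonoid
  using (sum-syntax; sum-cong-≗; ∑-distrib-+; sum-init-last)

∑-const : ∀ n c → ∑[ i < n ] c ≡ n * c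
∑-const zero    c = refl
∑-const (suc n) c = cong (c +_) (∑-const n c)

∑-1 : ∀ n → ∑[ i < n ] 1 ≡ n
∑-1 n = trans (∑-const n 1) (*-identityʳ n)

∑-mono-≤ : ∀ {n} {f g : Fin n → ℕ} → (∀ i → f i ≤ g i) → ∑[ i < n ] f i ≤ ∑[ i < n ] g i
∑-mono-≤ {zero}  f≤g = z≤n
∑-mono-≤ {suc n} f≤g = +-mono-≤ (f≤g zero) (∑-mono-≤ (f≤g ∘ suc))

sum-tabulate : ∀ {n} (g : Fin n → ℕ) → sum (tabulate g) ≡ ∑[ i < n ] g i
sum-tabulate {zero}  g = refl
sum-tabulate {suc n} g = cong (g zero +_) (sum-tabulate (g ∘ suc))

sum-map-allFin : ∀ {n} (g : Fin n → ℕ) → sum (map g (allFin n)) ≡ ∑[ i < n ] g i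
sum-map-allFin g = trans (cong sum (map-tabulate id g)) (sum-tabulate g)

sum-map-cartesianProduct : ∀ {A B : Set} (h : A × B → ℕ) (xs : List A) (ys : List B) →
  sum (map h (cartesianProduct xs ys)) ≡ sum (map (λ x → sum (map (λ y → h (x , y)) ys)) xs)
sum-map-cartesianProduct h []       ys = refl
sum-map-cartesianProduct h (x ∷ xs) ys = begin
  sum (map h (map (x ,_) ys ++ cartesianProduct xs ys))
    ≡⟨ cong sum (map-++ h (map (x ,_) ys) _) ⟩
  sum (map h (map (x ,_) ys) ++ map h (cartesianProduct xs ys))
    ≡⟨ sum-++ (map h (map (x ,_) ys)) _ ⟩
  sum (map h (map (x ,_) ys)) + sum (map h (cartesianProduct xs ys))
    ≡⟨ cong₂ _+_ (cong sum (sym (map-∘ ys))) (sum-map-cartesianProduct h xs ys) ⟩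
  sum (map (λ y → h (x , y)) ys) + sum (map (λ x → sum (map (λ y → h (x , y)) ys)) xs) ∎
  where open ≡-Reasoning

weight-Cycle⊗Cycle : ∀ {m n} (f : Fin m × Fin n → Label) →
  weight (Cycle m ⊗ Cycle n) f ≡ ∑[ x < m ] ∑[ y < n ] val (f (x , y))
weight-Cycle⊗Cycle {m} {n} f = begin
  sum (map (val ∘ f) (cartesianProduct (allFin m) (allFin n)))
    ≡⟨ sum-map-cartesianProduct (val ∘ f) (allFin m) (allFin n) ⟩
  sum (map (λ x → sum (map (λ y → val (f (x , y))) (allFin n))) (allFin m))
    ≡⟨ cong sum (map-cong (λ x → sum-map-allFin (λ y → val (f (x , y)))) (allFin m)) ⟩
  sum (map (λ x → ∑[ y < n ] val (f (x , y))) (allFin m))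
    ≡⟨ sum-map-allFin (λ x → ∑[ y < n ] val (f (x , y))) ⟩
  ∑[ x < m ] ∑[ y < n ] val (f (x , y)) ∎
  where open ≡-Reasoning

prev : ∀ {k} → Fin (suc k) → Fin (suc k)
prev {k} zero = fromℕ k
prev (suc i) = inject₁ i

Arc-Cycle⇒≡prev : ∀ {k} {i j : Fin (suc k)} → Arc (Cycle (suc k)) i j → i ≡ prev j
Arc-Cycle⇒≡prev {k} {j = zero}  (inj₂ (1+i≡1+k , _)) =
  toℕ-injective (trans (suc-injective 1+i≡1+k) (sym (toℕ-fromℕ k)))
Arc-Cycle⇒≡prev {j = suc j} (inj₁ 1+j≡1+i) =
  toℕ-injective (trans (sym (suc-injective 1+j≡1+i)) (sym (toℕ-inject₁ j)))

prev-Arc-Cycle : ∀ {k} (j : Fin (suc k)) → Arc (Cycle (suc k)) (prev j) j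
prev-Arc-Cycle {k} zero = inj₂ (cong suc (toℕ-fromℕ k) , refl)
prev-Arc-Cycle (suc j) = inj₁ (cong suc (sym (toℕ-inject₁ j)))

inject₁≢suc : ∀ {k} (i : Fin k) → inject₁ i ≢ suc i
inject₁≢suc zero ()
inject₁≢suc (suc i) = inject₁≢suc i ∘ suc-injectiveᶠ

prev≢ : ∀ {k} (i : Fin (suc (suc k))) → prev i ≢ i
prev≢ zero    ()
prev≢ (suc i) = inject₁≢suc i

∑-prev : ∀ {k} (f : Fin (suc k) → ℕ) → ∑[ i < suc k ] f (prev i) ≡ ∑[ i < suc k ] f i
∑-prev {k} f = trans (+-comm (f (fromℕ k)) _) (sym (sum-init-last f))

OneOf₃ : {A : Set} → A → A → A → A → Set
OneOf₃ p q r u = u ≡ p ⊎ u ≡ q ⊎ u ≡ r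

module _ {A : Set} (g : A → ℕ) {p q r : A} where

  ≤-sum₃ : ∀ {u} → OneOf₃ p q r u → g u ≤ g p + g q + g r
  ≤-sum₃ (inj₁ refl)        = ≤-trans (m≤m+n (g p) (g q)) (m≤m+n _ (g r))
  ≤-sum₃ (inj₂ (inj₁ refl)) = ≤-trans (m≤n+m (g q) (g p)) (m≤m+n _ (g r))
  ≤-sum₃ (inj₂ (inj₂ refl)) = m≤n+m (g r) _

  +-≤-sum₃ : ∀ {u v} → u ≢ v → OneOf₃ p q r u → OneOf₃ p q r v → g u + g v ≤ g p + g q + g r
  +-≤-sum₃ u≢v (inj₁ refl)        (inj₁ refl)        = contradiction refl u≢v
  +-≤-sum₃ u≢v (inj₂ (inj₁ refl)) (inj₂ (inj₁ refl)) = contradiction refl u≢v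
  +-≤-sum₃ u≢v (inj₂ (inj₂ refl)) (inj₂ (inj₂ refl)) = contradiction refl u≢v
  +-≤-sum₃ _ (inj₁ refl)        (inj₂ (inj₁ refl)) = m≤m+n (g p + g q) (g r)
  +-≤-sum₃ _ (inj₂ (inj₁ refl)) (inj₁ refl)        =
    ≤-trans (≤-reflexive (+-comm (g q) (g p))) (m≤m+n (g p + g q) (g r))
  +-≤-sum₃ _ (inj₁ refl)        (inj₂ (inj₂ refl)) = +-monoˡ-≤ (g r) (m≤m+n (g p) (g q))
  +-≤-sum₃ _ (inj₂ (inj₂ refl)) (inj₁ refl)        =
    ≤-trans (≤-reflexive (+-comm (g r) (g p))) (+-monoˡ-≤ (g r) (m≤m+n (g p) (g q)))
  +-≤-sum₃ _ (inj₂ (inj₁ refl)) (inj₂ (inj₂ refl)) = +-monoˡ-≤ (g r) (m≤n+m (g q) (g p))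
  +-≤-sum₃ _ (inj₂ (inj₂ refl)) (inj₂ (inj₁ refl)) =
    ≤-trans (≤-reflexive (+-comm (g r) (g q))) (+-monoˡ-≤ (g r) (m≤n+m (g q) (g p)))

atLeast2 : ℕ → ℕ
atLeast2 (suc (suc _)) = 1
atLeast2 _             = 0

atLeast2-step : ∀ s t → (s ≡ 0 → 2 ≤ t) → 1 + atLeast2 s ≤ s + atLeast2 t
atLeast2-step zero          zero          h = contradiction (h refl) λ ()
atLeast2-step zero          (suc zero)    h = contradiction (h refl) λ { (s≤s ()) }
atLeast2-step zero          (suc (suc _)) h = ≤-refl
atLeast2-step (suc zero)    t             h = m≤m+n 1 (atLeast2 t)
atLeast2-step (suc (suc s)) t             h = s≤s (s≤s z≤n)

length≤∑-cyclic : ∀ {N} (s : Fin (suc N) → ℕ) → (∀ y → s y ≡ 0 → 2 ≤ s (prev y)) →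
  suc N ≤ ∑[ y < suc N ] s y
length≤∑-cyclic {N} s zero⇒prev≥2 = +-cancelʳ-≤ P (suc N) (∑[ y < suc N ] s y) (begin
  suc N + P                                      ≡⟨ cong (_+ P) (sym (∑-1 (suc N))) ⟩
  ∑[ y < suc N ] 1 + P                           ≡⟨ ∑-distrib-+ (λ _ → 1) (atLeast2 ∘ s) ⟨
  ∑[ y < suc N ] (1 + atLeast2 (s y))            ≤⟨ ∑-mono-≤ (λ y → atLeast2-step (s y) (s (prev y)) (zero⇒prev≥2 y)) ⟩
  ∑[ y < suc N ] (s y + atLeast2 (s (prev y)))   ≡⟨ ∑-distrib-+ s (atLeast2 ∘ s ∘ prev) ⟩
  ∑[ y < suc N ] s y + ∑[ y < suc N ] atLeast2 (s (prev y)) ≡⟨ cong (∑[ y < suc N ] s y +_) (∑-prev (atLeast2 ∘ s)) ⟩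
  ∑[ y < suc N ] s y + P                         ∎)
  where
  open ≤-Reasoning
  P : ℕ
  P = ∑[ y < suc N ] atLeast2 (s y)

module _ {M N : ℕ} where

  private
    Torus : Digraph
    Torus = Cycle (suc M) ⊗ Cycle (suc N)

  inNeighbour-⊗ : ∀ {w} {x : Fin (suc M)} {y : Fin (suc N)} → Arc Torus w (x , y) →
    OneOf₃ (prev x , y) (x , prev y) (prev x , prev y) w
  inNeighbour-⊗ (inj₁ (a , b))        = inj₂ (inj₂ (cong₂ _,_ (Arc-Cycle⇒≡prev a) (Arc-Cycle⇒≡prev b)))
  inNeighbour-⊗ (inj₂ (inj₁ (e , b))) = inj₂ (inj₁ (cong₂ _,_ e (Arc-Cycle⇒≡prev b)))
  inNeighbour-⊗ (inj₂ (inj₂ (a , e))) = inj₁ (cong₂ _,_ (Arc-Cycle⇒≡prev a) e)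

  italian⇒inWeight≥2 : ∀ (f : V Torus → Label) → IsItalian Torus f → ∀ x y → val (f (x , y)) ≡ 0 →
    2 ≤ val (f (prev x , y)) + val (f (x , prev y)) + val (f (prev x , prev y))
  italian⇒inWeight≥2 f italian x y fxy≡0 with italian (x , y) fxy≡0
  ... | inj₁ (w , w→xy , fw≡2) =
    ≤-trans (≤-reflexive (sym fw≡2)) (≤-sum₃ (val ∘ f) (inNeighbour-⊗ w→xy))
  ... | inj₂ (u₁ , u₂ , u₁≢u₂ , u₁→xy , u₂→xy , fu₁≡1 , fu₂≡1) =
    ≤-trans (≤-reflexive (sym (cong₂ _+_ fu₁≡1 fu₂≡1)))
      (+-≤-sum₃ (val ∘ f) u₁≢u₂ (inNeighbour-⊗ u₁→xy) (inNeighbour-⊗ u₂→xy))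

  weight-lowerBound : ∀ (f : V Torus → Label) → IsItalian Torus f →
    suc M * suc N ≤ weight Torus f + weight Torus f
  weight-lowerBound f italian = begin
    m * n                                                  ≡⟨ ∑-const m n ⟨
    ∑[ x < m ] n                                           ≤⟨ ∑-mono-≤ (λ x → length≤∑-cyclic (columnPair x) (columnPair≡0⇒ x)) ⟩
    ∑[ x < m ] ∑[ y < n ] (F x y + F (prev x) y)          ≡⟨ sum-cong-≗ (λ x → ∑-distrib-+ (F x) (F (prev x))) ⟩
    ∑[ x < m ] (∑[ y < n ] F x y + ∑[ y < n ] F (prev x) y) ≡⟨ ∑-distrib-+ (∑F) (∑F ∘ prev) ⟩
    ∑[ x < m ] ∑F x + ∑[ x < m ] ∑F (prev x)              ≡⟨ cong (∑[ x < m ] ∑F x +_) (∑-prev ∑F) ⟩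
    ∑[ x < m ] ∑F x + ∑[ x < m ] ∑F x                     ≡⟨ cong₂ _+_ (weight-Cycle⊗Cycle f) (weight-Cycle⊗Cycle f) ⟨
    weight Torus f + weight Torus f                        ∎
    where
    open ≤-Reasoning
    m n : ℕ
    m = suc M
    n = suc N
    F : Fin m → Fin n → ℕ
    F x y = val (f (x , y))
    ∑F : Fin m → ℕ
    ∑F x = ∑[ y < n ] F x y
    columnPair : Fin m → Fin n → ℕ
    columnPair x y = F x y + F (prev x) y
    columnPair≡0⇒ : ∀ x y → columnPair x y ≡ 0 → 2 ≤ columnPair x (prev y)
    columnPair≡0⇒ x y pair≡0 =
      subst (λ a → 2 ≤ a + F x (prev y) + F (prev x) (prev y)) (m+n≡0⇒n≡0 (F x y) pair≡0)
        (italian⇒inWeight≥2 f italian x y (m+n≡0⇒m≡0 (F x y) pair≡0))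

∑-alternating-≤ : ∀ c (g : ℕ → ℕ) → (∀ k → g k + g (suc k) ≡ c) → (∀ k → g k + g k ≤ c + 1) →
  ∀ n → ∑[ i < n ] g (toℕ i) + ∑[ i < n ] g (toℕ i) ≤ n * c + 1
∑-alternating-≤ c g pair≡c double≤ zero = z≤n
∑-alternating-≤ c g pair≡c double≤ (suc zero) = begin
  g 0 + 0 + (g 0 + 0) ≡⟨ cong₂ _+_ (+-identityʳ (g 0)) (+-identityʳ (g 0)) ⟩
  g 0 + g 0           ≤⟨ double≤ 0 ⟩
  c + 1               ≡⟨ cong (_+ 1) (*-identityˡ c) ⟨
  1 * c + 1           ∎
  where open ≤-Reasoning
∑-alternating-≤ c g pair≡c double≤ (suc (suc n)) = begin
  (g 0 + (g 1 + T)) + (g 0 + (g 1 + T)) ≡⟨ cong₂ _+_ headPair≡ headPair≡ ⟩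
  (c + T) + (c + T)                     ≡⟨ +-interchange c T c T ⟩
  (c + c) + (T + T)                     ≤⟨ +-monoʳ-≤ (c + c) (∑-alternating-≤ c (λ k → g (2 + k)) (λ k → pair≡c (2 + k)) (λ k → double≤ (2 + k)) n) ⟩
  (c + c) + (n * c + 1)                 ≡⟨ +-assoc (c + c) (n * c) 1 ⟨
  (c + c + n * c) + 1                   ≡⟨ cong (_+ 1) (+-assoc c c (n * c)) ⟩
  suc (suc n) * c + 1                   ∎
  where
  open ≤-Reasoning
  T : ℕ
  T = ∑[ i < n ] g (suc (suc (toℕ i)))
  headPair≡ : g 0 + (g 1 + T) ≡ c + T
  headPair≡ = trans (sym (+-assoc (g 0) (g 1) T)) (cong (_+ T) (pair≡c 0))

checker : ℕ → Label
checker zero          = 1F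
checker (suc zero)    = 0F
checker (suc (suc k)) = checker k

checker-alternates : ∀ k → val (checker k) + val (checker (suc k)) ≡ 1
checker-alternates zero          = refl
checker-alternates (suc zero)    = refl
checker-alternates (suc (suc k)) = checker-alternates k

checker≤1 : ∀ k → val (checker k) ≤ 1
checker≤1 zero          = ≤-refl
checker≤1 (suc zero)    = z≤n
checker≤1 (suc (suc k)) = checker≤1 k

checker≡0⇒prev≡1 : ∀ k → val (checker (suc k)) ≡ 0 → val (checker k) ≡ 1
checker≡0⇒prev≡1 zero          _ = refl
checker≡0⇒prev≡1 (suc (suc k)) e = checker≡0⇒prev≡1 k e

checker≡1⊎next≡1 : ∀ k → val (checker k) ≡ 1 ⊎ val (checker (suc k)) ≡ 1
checker≡1⊎next≡1 zero          = inj₁ refl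
checker≡1⊎next≡1 (suc zero)    = inj₂ refl
checker≡1⊎next≡1 (suc (suc k)) = checker≡1⊎next≡1 k

checkerboard : ∀ {m n} → Fin m × Fin n → Label
checkerboard (x , y) = checker (toℕ x + toℕ y)

checkerboard-weight-≤ : ∀ m n →
  weight (Cycle m ⊗ Cycle n) checkerboard + weight (Cycle m ⊗ Cycle n) checkerboard ≤ m * n + 1
checkerboard-weight-≤ m n = begin
  weight (Cycle m ⊗ Cycle n) checkerboard + weight (Cycle m ⊗ Cycle n) checkerboard
    ≡⟨ cong₂ _+_ (weight-Cycle⊗Cycle {m} {n} checkerboard) (weight-Cycle⊗Cycle {m} {n} checkerboard) ⟩
  ∑[ x < m ] row (toℕ x) + ∑[ x < m ] row (toℕ x)
    ≤⟨ ∑-alternating-≤ n row rows-alternate row-double≤ m ⟩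
  m * n + 1 ∎
  where
  open ≤-Reasoning
  row : ℕ → ℕ
  row s = ∑[ y < n ] val (checker (s + toℕ y))
  rows-alternate : ∀ s → row s + row (suc s) ≡ n
  rows-alternate s = trans
    (sym (∑-distrib-+ {n} (λ y → val (checker (s + toℕ y))) (λ y → val (checker (suc s + toℕ y)))))
    (trans (sum-cong-≗ {n} (λ y → checker-alternates (s + toℕ y))) (∑-1 n))
  row-double≤ : ∀ s → row s + row s ≤ n + 1
  row-double≤ s = subst (λ k → row s + row s ≤ k + 1) (*-identityʳ n)
    (∑-alternating-≤ 1 (λ k → val (checker (s + k)))
      (λ k → trans (cong (λ j → val (checker (s + k)) + val (checker j)) (+-suc s k))
                   (checker-alternates (s + k)))
      (λ k → +-mono-≤ (checker≤1 (s + k)) (checker≤1 (s + k)))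
      n)

TwoInNeighboursLabelled1 : (D : Digraph) → (V D → Label) → V D → Set
TwoInNeighboursLabelled1 D f v = Σ (V D) λ u₁ → Σ (V D) λ u₂ →
  u₁ ≢ u₂ × Arc D u₁ v × Arc D u₂ v × val (f u₁) ≡ 1 × val (f u₂) ≡ 1

module _ {a b : ℕ} where

  private
    Torus : Digraph
    Torus = Cycle (suc (suc a)) ⊗ Cycle (suc (suc b))
    board : V Torus → Label
    board = checkerboard

  checkerboard-interior : ∀ x y → val (board (suc x , suc y)) ≡ 0 →
    TwoInNeighboursLabelled1 Torus board (suc x , suc y)
  checkerboard-interior x y xy≡0 =
    ( (prev (suc x) , suc y) , (suc x , prev (suc y)) , prev≢ (suc x) ∘ cong proj₁
    , inj₂ (inj₂ (prev-Arc-Cycle (suc x) , refl)) , inj₂ (inj₁ (refl , prev-Arc-Cycle (suc y)))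
    , left≡1 , below≡1 )
    where
    oneLess≡1 : val (checker (toℕ x + suc (toℕ y))) ≡ 1
    oneLess≡1 = checker≡0⇒prev≡1 (toℕ x + suc (toℕ y)) xy≡0
    left≡1 : val (checker (toℕ (inject₁ x) + suc (toℕ y))) ≡ 1
    left≡1 rewrite toℕ-inject₁ x = oneLess≡1
    below≡1 : val (checker (suc (toℕ x) + toℕ (inject₁ y))) ≡ 1
    below≡1 rewrite toℕ-inject₁ y | sym (+-suc (toℕ x) (toℕ y)) = oneLess≡1

  -- Across the wrap-around, column prev 0 = m − 1 need not have the parity of column 0,
  -- but its cells in rows y − 1 and y alternate, so one of them is labelled 1.
  checkerboard-firstColumn : ∀ y → val (board (zero , suc y)) ≡ 0 →
    TwoInNeighboursLabelled1 Torus board (zero , suc y)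
  checkerboard-firstColumn y xy≡0 with checker≡1⊎next≡1 (suc a + toℕ y)
  ... | inj₁ e =
    ( (zero , prev (suc y)) , (prev zero , prev (suc y)) , prev≢ zero ∘ sym ∘ cong proj₁
    , inj₂ (inj₁ (refl , prev-Arc-Cycle (suc y))) , inj₁ (prev-Arc-Cycle zero , prev-Arc-Cycle (suc y))
    , below≡1 , wrapped≡1 )
    where
    below≡1 : val (checker (toℕ (inject₁ y))) ≡ 1
    below≡1 rewrite toℕ-inject₁ y = checker≡0⇒prev≡1 (toℕ y) xy≡0
    wrapped≡1 : val (checker (toℕ (fromℕ (suc a)) + toℕ (inject₁ y))) ≡ 1
    wrapped≡1 rewrite toℕ-fromℕ a | toℕ-inject₁ y = e
  ... | inj₂ e =
    ( (zero , prev (suc y)) , (prev zero , suc y) , prev≢ zero ∘ sym ∘ cong proj₁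
    , inj₂ (inj₁ (refl , prev-Arc-Cycle (suc y))) , inj₂ (inj₂ (prev-Arc-Cycle zero , refl))
    , below≡1 , wrapped≡1 )
    where
    below≡1 : val (checker (toℕ (inject₁ y))) ≡ 1
    below≡1 rewrite toℕ-inject₁ y = checker≡0⇒prev≡1 (toℕ y) xy≡0
    wrapped≡1 : val (checker (toℕ (fromℕ (suc a)) + suc (toℕ y))) ≡ 1
    wrapped≡1 rewrite toℕ-fromℕ a | +-suc (suc a) (toℕ y) = e

  checkerboard-firstRow : ∀ x → val (board (suc x , zero)) ≡ 0 →
    TwoInNeighboursLabelled1 Torus board (suc x , zero)
  checkerboard-firstRow x xy≡0 with checker≡1⊎next≡1 (toℕ x + suc b)
  ... | inj₁ e =
    ( (prev (suc x) , zero) , (prev (suc x) , prev zero) , prev≢ zero ∘ sym ∘ cong proj₂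
    , inj₂ (inj₂ (prev-Arc-Cycle (suc x) , refl)) , inj₁ (prev-Arc-Cycle (suc x) , prev-Arc-Cycle zero)
    , left≡1 , wrapped≡1 )
    where
    left≡1 : val (checker (toℕ (inject₁ x) + 0)) ≡ 1
    left≡1 rewrite toℕ-inject₁ x = checker≡0⇒prev≡1 (toℕ x + 0) xy≡0
    wrapped≡1 : val (checker (toℕ (inject₁ x) + toℕ (fromℕ (suc b)))) ≡ 1
    wrapped≡1 rewrite toℕ-inject₁ x | toℕ-fromℕ b = e
  ... | inj₂ e =
    ( (prev (suc x) , zero) , (suc x , prev zero) , prev≢ zero ∘ sym ∘ cong proj₂
    , inj₂ (inj₂ (prev-Arc-Cycle (suc x) , refl)) , inj₂ (inj₁ (refl , prev-Arc-Cycle zero))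
    , left≡1 , wrapped≡1 )
    where
    left≡1 : val (checker (toℕ (inject₁ x) + 0)) ≡ 1
    left≡1 rewrite toℕ-inject₁ x = checker≡0⇒prev≡1 (toℕ x + 0) xy≡0
    wrapped≡1 : val (checker (suc (toℕ x) + toℕ (fromℕ (suc b)))) ≡ 1
    wrapped≡1 rewrite toℕ-fromℕ b = e

  checkerboard-italian : IsItalian Torus checkerboard
  checkerboard-italian (zero  , zero)  ()
  checkerboard-italian (suc x , suc y) xy≡0 = inj₂ (checkerboard-interior x y xy≡0)
  checkerboard-italian (zero  , suc y) xy≡0 = inj₂ (checkerboard-firstColumn y xy≡0)
  checkerboard-italian (suc x , zero)  xy≡0 = inj₂ (checkerboard-firstRow x xy≡0)

double≡*2 : ∀ w → w + w ≡ w * 2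
double≡*2 w = trans (cong (w +_) (sym (+-identityʳ w))) (*-comm 2 w)

⌈/2⌉-least : ∀ {k w} → k ≤ w + w → ⌈ k /2⌉ ≤ w
⌈/2⌉-least {k} {w} k≤2w = ≤-pred (m<n*o⇒m/o<n k+1<[1+w]*2)
  where
  open ≤-Reasoning
  k+1<[1+w]*2 : k + 1 < suc w * 2
  k+1<[1+w]*2 = begin-strict
    k + 1             ≡⟨ +-comm k 1 ⟩
    suc k             ≤⟨ s≤s k≤2w ⟩
    suc (w + w)       <⟨ n<1+n _ ⟩
    suc (suc (w + w)) ≡⟨ cong (λ t → suc (suc t)) (double≡*2 w) ⟩
    suc w * 2         ∎

⌈/2⌉-greatest : ∀ {k w} → w + w ≤ k + 1 → w ≤ ⌈ k /2⌉
⌈/2⌉-greatest {k} {w} 2w≤k+1 = begin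
  w           ≡⟨ m*n/n≡m w 2 ⟨
  w * 2 / 2   ≤⟨ /-monoˡ-≤ 2 (subst (_≤ k + 1) (double≡*2 w) 2w≤k+1) ⟩
  (k + 1) / 2 ∎
  where open ≤-Reasoning

theorem2p5 : (m n : ℕ) → (hm : 2 ≤ m) → (hn : 2 ≤ n) →
    ItalianDominationNumber (Cycle m ⊗ Cycle n) ⌈ m * n /2⌉
theorem2p5 m@(suc (suc _)) n@(suc (suc _)) (s≤s (s≤s z≤n)) (s≤s (s≤s z≤n)) =
    ( checkerboard , checkerboard-italian
    , ≤-antisym (⌈/2⌉-greatest {m * n} upper) (⌈/2⌉-least {m * n} lower) )
  , λ f italian → ⌈/2⌉-least {m * n} (weight-lowerBound f italian)
  where
  W : ℕ
  W = weight (Cycle m ⊗ Cycle n) checkerboard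
  upper : W + W ≤ m * n + 1
  upper = checkerboard-weight-≤ m n
  lower : m * n ≤ W + W
  lower = weight-lowerBound checkerboard checkerboard-italian
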